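{- Let $k\ge 2$, let $G$ be a finite simple $k$-chromatic graph and let $u,v$ be distinct vertices of $G$. Let $c$ be any $k$-coloring of $G$. (1) If $\{u,v\}$ is an implicit-edge of $G$, then $u$ and $v$ lie in the same connected component of the subgraph of $G$ induced by the vertices of colors $c(u)$ and $c(v)$ (i.e. there is a 2-color chain with colors $c(u),c(v)$ containing both $u$ and $v$). (2) If $\{u,v\}$ is an implicit-identity of $G$, then for every color $i\in\{1,\dots,k\}\setminus\{c(u)\}$, $u$ and $v$ lie in the same connected component of the subgraph of $G$ induced by the vertices of colors $c(u)$ and $i$ (so there are $k-1$ such 2-color chains, each containing both $u$ and $v$).
   Context: All graphs are finite and simple. For a positive integer $k$, a $k$-coloring of a graph $G$ is a proper vertex coloring $c:V(G)\to\{1,\dots,k\}$; $\chi(G)$ is the chromatic number and $G$ is $k$-chromatic if $\chi(G)=k$. For distinct vertices $u,v$, $G-uv$ denotes $G$ with the edge $uv$ deleted if present (and $G$ otherwise). For a $k$-chromatic graph $G$: $\{u,v\}$ is an implicit-edge of $G$ if no $k$-coloring $c$ of $G-uv$ has $c(u)=c(v)$, and an implicit-identity of $G$ if no $k$-coloring $c$ of $G-uv$ has $c(u)\neq c(v)$. Given a coloring $c$ and two colors $a,b$, a 2-color chain (Kempe chain) with colors $a,b$ is a maximal connected subgraph all of whose vertices have color $a$ or $b$. -}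

module Defs where

open import Data.Nat using (ℕ; _<_)
open import Data.Fin using (Fin)
open import Data.Bool using (Bool; true; false)
open import Data.Sum using (_⊎_)
open import Data.Product using (Σ; _×_)
open import Relation.Nullary using (¬_)
open import Relation.Binary.PropositionalEquality using (_≡_; _≢_)

record Graph (n : ℕ) : Set where
  field
    adj    : Fin n → Fin n → Bool
    sym    : ∀ x y → adj x y ≡ adj y x
    irrefl : ∀ x → adj x x ≡ false
open Graph public

Adjacent : ∀ {n} → Graph n → Fin n → Fin n → Set
Adjacent G x y = adj G x y ≡ true

AdjacentMinus : ∀ {n} → Graph n → Fin n → Fin n → Fin n → Fin n → Set
AdjacentMinus G u v x y =
  Adjacent G x y × ¬ (x ≡ u × y ≡ v) × ¬ (x ≡ v × y ≡ u)

IsProper : ∀ {n} → (Fin n → Fin n → Set) → (k : ℕ) → (Fin n → Fin k) → Set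
IsProper E k c = ∀ x y → E x y → c x ≢ c y

IsColoring : ∀ {n} → Graph n → (k : ℕ) → (Fin n → Fin k) → Set
IsColoring G = IsProper (Adjacent G)

IsColoringMinus : ∀ {n} → Graph n → Fin n → Fin n → (k : ℕ) → (Fin n → Fin k) → Set
IsColoringMinus G u v = IsProper (AdjacentMinus G u v)

Colorable : ∀ {n} → Graph n → ℕ → Set
Colorable {n} G k = Σ (Fin n → Fin k) (IsColoring G k)

IsChromatic : ∀ {n} → Graph n → ℕ → Set
IsChromatic G k = Colorable G k × (∀ j → j < k → ¬ Colorable G j)

ImplicitEdge : ∀ {n} → Graph n → ℕ → Fin n → Fin n → Set
ImplicitEdge {n} G k u v =
  ∀ (c : Fin n → Fin k) → IsColoringMinus G u v k c → c u ≢ c v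

ImplicitIdentity : ∀ {n} → Graph n → ℕ → Fin n → Fin n → Set
ImplicitIdentity {n} G k u v =
  ∀ (c : Fin n → Fin k) → IsColoringMinus G u v k c → c u ≡ c v

data WalkIn {n} (G : Graph n) (P : Fin n → Set) : Fin n → Fin n → Set where
  here : ∀ {x} → P x → WalkIn G P x x
  step : ∀ {x y z} → P x → Adjacent G x y → WalkIn G P y z → WalkIn G P x z

SameKempeChain : ∀ {n k} → Graph n → (Fin n → Fin k) → Fin k → Fin k → Fin n → Fin n → Set
SameKempeChain G c a b x y = WalkIn G (λ w → c w ≡ a ⊎ c w ≡ b) x y

module Submission where

-- The proof is the classical Kempe interchange argument.  Fix a proper
-- k-colouring c and two colours a, b.  If u and v are NOT joined by a walk
-- through vertices coloured a or b, swap a and b on the whole a/b-component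
-- of u.  The result is again a proper colouring c' of G (hence of G - uv),
-- with c' u = swap(c u) and c' v = c v.
--   (1) For an implicit-edge take a = c u, b = c v: then c' u = c v = c' v,
--       which an implicit-edge forbids.
--   (2) For an implicit-identity take a = c u, b = i ≠ c u: then c u = c v
--       and c' u = c' v, so i = c' u = c' v = c v = c u, a contradiction.
--
-- The interchange needs to decide, for each vertex w, whether w lies in the
-- a/b-component of u.

open import Defs hiding (sym)
open import Data.Nat using (ℕ; _≤_; _<_)
open import Data.Nat.Induction using (<-wellFounded)
open import Data.Fin using (Fin; _≟_)
open import Data.Fin.Subset using (Subset; _∈_; _-_; ⊤; ∣_∣)
open import Data.Fin.Subset.Properties
  using (_∈?_; ∈⊤; x∈p⇒∣p-x∣<∣p∣; x∈p∧x≢y⇒x∈p-y; p─q⊆p)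
open import Data.Fin.Properties using (any?)
open import Data.Fin.Permutation.Components using (transpose; transpose-inverse)
open import Data.Bool using (true; if_then_else_)
import Data.Bool.Properties as Bool
open import Data.Product using (Σ; ∃-syntax; _×_; _,_; proj₁; proj₂; map₂)
open import Data.Sum using (_⊎_; inj₁; inj₂)
open import Data.Empty using (⊥-elim)
open import Function using (_∘_)
open import Level using (0ℓ)
open import Induction.WellFounded using (Acc; acc)
open import Relation.Unary using (Pred; Decidable)
open import Relation.Nullary using (¬_; Dec; yes; no; does)
open import Relation.Nullary.Decidable using (_×-dec_; _⊎-dec_; map′; dec-true; dec-false)
open import Relation.Binary.PropositionalEquality
  using (_≡_; _≢_; refl; sym; trans; cong; module ≡-Reasoning)

module Walks {n : ℕ} (G : Graph n) where

  mapWalk : ∀ {P Q : Pred (Fin n) 0ℓ} → (∀ {x} → P x → Q x) →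
            ∀ {x y} → WalkIn G P x y → WalkIn G Q x y
  mapWalk f (here p)       = here (f p)
  mapWalk f (step p e r)   = step (f p) e (mapWalk f r)

  walk-head : ∀ {P x y} → WalkIn G P x y → P x
  walk-head (here p)     = p
  walk-head (step p _ _) = p

  walk-last : ∀ {P x y} → WalkIn G P x y → P y
  walk-last (here p)     = p
  walk-last (step _ _ r) = walk-last r

  extend : ∀ {P x y z} → WalkIn G P x y → P y → Adjacent G y z → P z →
           WalkIn G P x z
  extend (here _)     py e pz = step py e (here pz)
  extend (step p d r) py e pz = step p d (extend r py e pz)

  Within : Pred (Fin n) 0ℓ → Subset n → Pred (Fin n) 0ℓ
  Within P S x = P x × x ∈ S

  avoid-or-leave : ∀ {P S v y w} → w ≢ v → WalkIn G (Within P S) y w →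
    WalkIn G (Within P (S - v)) y w
      ⊎ ∃[ x ] (Adjacent G v x × WalkIn G (Within P (S - v)) x w)
  avoid-or-leave w≢v (here (p , w∈S)) = inj₁ (here (p , x∈p∧x≢y⇒x∈p-y w∈S w≢v))
  avoid-or-leave {v = v} w≢v (step {y} (p , y∈S) y~z r) with avoid-or-leave w≢v r
  ... | inj₂ later = inj₂ later
  ... | inj₁ r′ with y ≟ v
  ...   | yes refl = inj₂ (_ , y~z , r′)
  ...   | no y≢v   = inj₁ (step (p , x∈p∧x≢y⇒x∈p-y y∈S y≢v) y~z r′)

  leave : ∀ {P S v w} → v ≢ w → WalkIn G (Within P S) v w →
          ∃[ x ] (Adjacent G v x × WalkIn G (Within P (S - v)) x w)
  leave v≢w (here _) = ⊥-elim (v≢w refl)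
  leave v≢w (step _ v~x r) with avoid-or-leave (v≢w ∘ sym) r
  ... | inj₁ r′    = _ , v~x , r′
  ... | inj₂ later = later

  -- Reachability inside Within P S is decidable, by recursion on ∣ S ∣:
  -- a walk from v to w ≠ v is an edge v ~ x followed by a walk in S - v.
  walkWithin? : ∀ {P} → Decidable P → (S : Subset n) → Acc _<_ ∣ S ∣ →
                ∀ v w → Dec (WalkIn G (Within P S) v w)
  walkWithin? P? S (acc smaller) v w with P? v ×-dec (v ∈? S)
  ... | no v∉ = no (v∉ ∘ walk-head)
  ... | yes v∈ with v ≟ w
  ...   | yes refl = yes (here v∈)
  ...   | no v≢w with any? (λ x → (adj G v x Bool.≟ true)
                      ×-dec walkWithin? P? (S - v)
                              (smaller (x∈p⇒∣p-x∣<∣p∣ (proj₂ v∈))) x w)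
  ...     | yes (x , v~x , r) = yes (step v∈ v~x (mapWalk (map₂ (p─q⊆p S _)) r))
  ...     | no none           = no (none ∘ leave v≢w)

  walk? : ∀ {P} → Decidable P → ∀ v w → Dec (WalkIn G P v w)
  walk? P? v w =
    map′ (mapWalk proj₁) (mapWalk (_, ∈⊤)) (walkWithin? P? ⊤ (<-wellFounded _) v w)

module _ {k : ℕ} where

  transpose-moves : (a b : Fin k) → transpose a b a ≡ b
  transpose-moves a b rewrite dec-true (a ≟ a) refl = refl

  transpose-fixes : (a b t : Fin k) → t ≢ a → t ≢ b → transpose a b t ≡ t
  transpose-fixes a b t t≢a t≢b
    rewrite dec-false (t ≟ a) t≢a | dec-false (t ≟ b) t≢b = refl

  transpose-injective : (a b : Fin k) {s t : Fin k} →
                        transpose a b s ≡ transpose a b t → s ≡ t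
  transpose-injective a b {s} {t} eq = begin
    s                                  ≡⟨ sym (transpose-inverse b a) ⟩
    transpose b a (transpose a b s)    ≡⟨ cong (transpose b a) eq ⟩
    transpose b a (transpose a b t)    ≡⟨ transpose-inverse b a ⟩
    t                                  ∎
    where open ≡-Reasoning

coloring-minus : ∀ {n k} (G : Graph n) (u v : Fin n) (c : Fin n → Fin k) →
                 IsColoring G k c → IsColoringMinus G u v k c
coloring-minus G u v c proper x y e = proper x y (proj₁ e)

module Kempe {n k : ℕ} (G : Graph n) (c : Fin n → Fin k)
             (proper : IsColoring G k c) (a b : Fin k) where

  open Walks G

  TwoColored : Pred (Fin n) 0ℓ
  TwoColored w = c w ≡ a ⊎ c w ≡ b

  interchange : ∀ {R : Pred (Fin n) 0ℓ} → Decidable R → Fin n → Fin k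
  interchange R? w = if does (R? w) then transpose a b (c w) else c w

  interchange-inside : ∀ {R : Pred (Fin n) 0ℓ} (R? : Decidable R) {w} →
                       R w → interchange R? w ≡ transpose a b (c w)
  interchange-inside R? {w} rw rewrite dec-true (R? w) rw = refl

  interchange-outside : ∀ {R : Pred (Fin n) 0ℓ} (R? : Decidable R) {w} →
                        ¬ R w → interchange R? w ≡ c w
  interchange-outside R? {w} ¬rw rewrite dec-false (R? w) ¬rw = refl

  -- An edge leaving a set R closed under a/b-coloured neighbours goes to a
  -- vertex of a third colour, so it stays proper after swapping on R.
  boundary-edge : ∀ {R : Pred (Fin n) 0ℓ} →
    (∀ {x y} → R x → Adjacent G x y → TwoColored y → R y) →
    ∀ {x y} → R x → ¬ R y → Adjacent G x y → transpose a b (c x) ≢ c y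
  boundary-edge closed {x} {y} rx ¬ry x~y swapped =
    proper x y x~y (transpose-injective a b swapped′)
    where
      third : ¬ TwoColored y
      third = ¬ry ∘ closed rx x~y
      swapped′ : transpose a b (c x) ≡ transpose a b (c y)
      swapped′ = trans swapped (sym (transpose-fixes a b (c y)
                   (third ∘ inj₁) (third ∘ inj₂)))

  interchange-proper : ∀ {R : Pred (Fin n) 0ℓ} (R? : Decidable R) →
    (∀ {x y} → R x → Adjacent G x y → TwoColored y → R y) →
    IsColoring G k (interchange R?)
  interchange-proper R? closed x y x~y eq with R? x | R? y
  ... | yes _  | yes _  = proper x y x~y (transpose-injective a b eq)
  ... | no _   | no _   = proper x y x~y eq
  ... | yes rx | no ¬ry = boundary-edge closed rx ¬ry x~y eq
  ... | no ¬rx | yes ry =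
    boundary-edge closed ry ¬rx (trans (Graph.sym G y x) x~y) (sym eq)

  chain? : ∀ u → Decidable (SameKempeChain G c a b u)
  chain? = walk? (λ w → (c w ≟ a) ⊎-dec (c w ≟ b))

  chain-closed : ∀ {u x y} → SameKempeChain G c a b u x → Adjacent G x y →
                 TwoColored y → SameKempeChain G c a b u y
  chain-closed r x~y y-ab = extend r (walk-last r) x~y y-ab

  chain-or-recolor : ∀ u v → TwoColored u →
    SameKempeChain G c a b u v
      ⊎ Σ (Fin n → Fin k) (λ c′ → IsColoring G k c′
                              × c′ u ≡ transpose a b (c u) × c′ v ≡ c v)
  chain-or-recolor u v u-ab with chain? u v
  ... | yes uv-chain = inj₁ uv-chain
  ... | no  ¬uv-chain =
    inj₂ ( interchange (chain? u)
         , interchange-proper (chain? u) chain-closed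
         , interchange-inside (chain? u) (here u-ab)
         , interchange-outside (chain? u) ¬uv-chain )

theorem3p11 : (k : ℕ) → 2 ≤ k → {n : ℕ} → (G : Graph n) → IsChromatic G k →
    (u v : Fin n) → u ≢ v → (c : Fin n → Fin k) → IsColoring G k c →
    (ImplicitEdge G k u v → SameKempeChain G c (c u) (c v) u v)
    × (ImplicitIdentity G k u v →
    ∀ (i : Fin k) → i ≢ c u → SameKempeChain G c (c u) i u v)
theorem3p11 k _ G _ u v _ c proper = through-edge , through-identity
  where
    through-edge : ImplicitEdge G k u v → SameKempeChain G c (c u) (c v) u v
    through-edge implicit with Kempe.chain-or-recolor G c proper (c u) (c v) u v (inj₁ refl)
    ... | inj₁ chain = chain
    ... | inj₂ (c′ , proper′ , c′u , c′v) =
      ⊥-elim (implicit c′ (coloring-minus G u v c′ proper′)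
        (trans c′u (trans (transpose-moves (c u) (c v)) (sym c′v))))

    through-identity : ImplicitIdentity G k u v →
      ∀ (i : Fin k) → i ≢ c u → SameKempeChain G c (c u) i u v
    through-identity implicit i i≢cu with Kempe.chain-or-recolor G c proper (c u) i u v (inj₁ refl)
    ... | inj₁ chain = chain
    ... | inj₂ (c′ , proper′ , c′u , c′v) = ⊥-elim (i≢cu (begin
      i                        ≡⟨ sym (transpose-moves (c u) i) ⟩
      transpose (c u) i (c u)  ≡⟨ sym c′u ⟩
      c′ u                     ≡⟨ implicit c′ (coloring-minus G u v c′ proper′) ⟩
      c′ v                     ≡⟨ c′v ⟩
      c v                      ≡⟨ sym (implicit c (coloring-minus G u v c proper)) ⟩
      c u                      ∎))
      where open ≡-Reasoning
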